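{- Let $s,b\ge1$ be integers and $\{a_i\}$ the $(s,b)$-Generacci sequence. If a positive integer $k$ has an $(s,b)$-Generacci legal decomposition using summands from $\{a_1,\dots,a_p\}$, then so does $k-1$ (where $0$ is regarded as having the empty decomposition).
   Context: For fixed integers $s,b\ge1$ and an increasing sequence of positive integers $\{a_i\}_{i\ge1}$, the bins are $\mathcal{B}_n=\{a_{b(n-1)+1},\dots,a_{bn}\}$ for $n\ge1$, with $\mathcal{B}_j=\emptyset$ for $j\le0$. A decomposition $m=a_{\ell_1}+\cdots+a_{\ell_k}$ with $a_{\ell_1}>\cdots>a_{\ell_k}$ is an $(s,b)$-Generacci legal decomposition if $\{a_{\ell_i},a_{\ell_{i+1}}\}\not\subset\mathcal{B}_{j-s}\cup\cdots\cup\mathcal{B}_j$ for all $i,j$. The $(s,b)$-Generacci sequence is the increasing sequence of positive integers $\{a_i\}$ in which each $a_i$ is the smallest positive integer with no $(s,b)$-Generacci legal decomposition using elements of $\{a_1,\dots,a_{i-1}\}$. -}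

module Defs where

open import Data.Nat using (ℕ; zero; suc; _+_; _*_; _∸_; _≤_; _<_)
open import Data.List using (List; map)
open import Data.Nat.ListAction using (sum)
open import Data.List.Relation.Unary.All using (All)
open import Data.List.Relation.Unary.Linked using (Linked)
open import Data.Product using (Σ; ∃; _×_)
open import Relation.Nullary using (¬_)
open import Relation.Binary.PropositionalEquality using (_≡_)

-- Sequences are 1-indexed: a : ℕ → ℕ, with a 0 unused.
-- Bin  B_n = {a_{b(n-1)+1}, ..., a_{bn}}  for n ≥ 1 (empty for n ≤ 0).
-- We record membership of the term a_ℓ in B_n via its index ℓ.
InBin : (b ℓ n : ℕ) → Set
InBin b ℓ n = (1 ≤ n) × (b * (n ∸ 1) + 1 ≤ ℓ) × (ℓ ≤ b * n)

-- a_ℓ ∈ B_{j-s} ∪ ... ∪ B_j  (bins with non-positive index are empty,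
-- so it suffices to let j range over ℕ).
InWindow : (s b j ℓ : ℕ) → Set
InWindow s b j ℓ = ∃ λ n → (n ≤ j) × (j ≤ n + s) × InBin b ℓ n

LegalPair : (s b : ℕ) (a : ℕ → ℕ) (ℓ ℓ' : ℕ) → Set
LegalPair s b a ℓ ℓ' =
  (a ℓ' < a ℓ) × (¬ (∃ λ j → InWindow s b j ℓ × InWindow s b j ℓ'))

record LegalDecomp (s b : ℕ) (a : ℕ → ℕ) (p m : ℕ) : Set where
  field
    indices : List ℕ
    inRange : All (λ ℓ → (1 ≤ ℓ) × (ℓ ≤ p)) indices
    legal   : Linked (LegalPair s b a) indices
    sums    : sum (map a indices) ≡ m

HasLegalDecomp : (s b : ℕ) (a : ℕ → ℕ) (p m : ℕ) → Set
HasLegalDecomp s b a p m = LegalDecomp s b a p m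

record IsGeneracci (s b : ℕ) (a : ℕ → ℕ) : Set where
  field
    increasing : ∀ i → 1 ≤ i → a i < a (suc i)
    positive   : ∀ i → 1 ≤ i → 1 ≤ a i
    noDecomp   : ∀ i → 1 ≤ i → ¬ HasLegalDecomp s b a (i ∸ 1) (a i)
    smallest   : ∀ i → 1 ≤ i → ∀ m → 1 ≤ m → m < a i → HasLegalDecomp s b a (i ∸ 1) m

-- Replace the last summand a_h of a legal decomposition of k by a legal
-- decomposition of a_h − 1 over {a_1, …, a_{h−1}}, which exists by the minimality
-- of a_h (the empty one if a_h = 1). Its leading index y is below h, so bin(y) ≤
-- bin(h); hence the summand preceding a_h, which shared no window of s+1 bins
-- with a_h, shares none with a_y either, and the new decomposition of k − 1 is legal.
module Submission where

open import Defs
open import Data.Nat using (ℕ; zero; suc; _+_; _*_; _∸_; _≤_; _<_; z≤n; s≤s; _≤?_)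
open import Data.Nat.Properties
open import Data.List using ([]; _∷_; map)
open import Data.Nat.ListAction using (sum)
open import Data.List.Relation.Unary.All as All using (All; []; _∷_)
open import Data.List.Relation.Unary.Linked using (Linked; []; [-]; _∷_)
open import Data.Product using (∃; _×_; _,_; proj₁)
open import Data.Sum using (inj₁; inj₂)
open import Relation.Nullary using (yes; no)
open import Relation.Binary.PropositionalEquality using (_≡_; refl; sym; cong; subst)

module Bins (b : ℕ) where

  inBin⇒1≤ : ∀ {ℓ n} → InBin b ℓ n → 1 ≤ ℓ
  inBin⇒1≤ (_ , lo , _) = ≤-trans (m≤n+m 1 _) lo

  inBin-mono : ∀ {u v nu nv} → u ≤ v → InBin b u nu → InBin b v nv → nu ≤ nv
  inBin-mono {nu = suc n} {nv} u≤v (_ , lo , _) (_ , _ , hi) =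
    *-cancelˡ-< b n nv (<-≤-trans (m<m+n (b * n) (s≤s z≤n)) (≤-trans lo (≤-trans u≤v hi)))

  inBin-exists : 1 ≤ b → ∀ ℓ → 1 ≤ ℓ → ∃ (InBin b ℓ)
  inBin-exists 1≤b (suc zero) _ =
    1 , s≤s z≤n , ≤-reflexive (cong (_+ 1) (*-zeroʳ b)) , ≤-trans 1≤b (≤-reflexive (sym (*-identityʳ b)))
  inBin-exists 1≤b (suc (suc m)) _ with inBin-exists 1≤b (suc m) (s≤s z≤n)
  ... | zero , () , _
  ... | suc n , _ , lo , hi with suc (suc m) ≤? b * suc n
  ...   | yes ℓ≤ = suc n , s≤s z≤n , ≤-trans lo (n≤1+n _) , ℓ≤
  ...   | no ℓ≰ = suc (suc n) , s≤s z≤n , next-lo , next-hi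
    where
      m-last : suc m ≡ b * suc n
      m-last = ≤-antisym hi (≤-pred (≰⇒> ℓ≰))
      next-lo : b * suc n + 1 ≤ suc (suc m)
      next-lo = ≤-reflexive (subst (λ t → t + 1 ≡ suc (suc m)) m-last (+-comm (suc m) 1))
      next-hi : suc (suc m) ≤ b * suc (suc n)
      next-hi = begin
        suc (suc m)     ≡⟨ cong suc m-last ⟩
        1 + b * suc n   ≤⟨ +-monoˡ-≤ (b * suc n) 1≤b ⟩
        b + b * suc n   ≡⟨ sym (*-suc b (suc n)) ⟩
        b * suc (suc n) ∎
        where open ≤-Reasoning

module Windows (s b : ℕ) where
  open Bins b

  SharesWindow : (x y : ℕ) → Set
  SharesWindow x y = ∃ λ j → InWindow s b j x × InWindow s b j y

  sharesWindow⇒1≤ : ∀ {x y} → SharesWindow x y → 1 ≤ x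
  sharesWindow⇒1≤ (_ , (_ , _ , _ , x∈) , _) = inBin⇒1≤ x∈

  sharesWindow-between : 1 ≤ b → ∀ {x ℓ y} → y ≤ ℓ → ℓ ≤ x →
                         SharesWindow x y → SharesWindow x ℓ
  sharesWindow-between 1≤b {ℓ = ℓ} y≤ℓ ℓ≤x (j , (nx , nx≤j , _ , x∈) , (ny , _ , j≤ny+s , y∈))
    with inBin-exists 1≤b ℓ (≤-trans (inBin⇒1≤ y∈) y≤ℓ)
  ... | nℓ , ℓ∈ = nx , (nx , ≤-refl , m≤m+n nx s , x∈) , (nℓ , inBin-mono ℓ≤x ℓ∈ x∈ , nx≤nℓ+s , ℓ∈)
    where
      nx≤nℓ+s : nx ≤ nℓ + s
      nx≤nℓ+s = ≤-trans nx≤j (≤-trans j≤ny+s (+-monoˡ-≤ s (inBin-mono y≤ℓ y∈ ℓ∈)))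

InRange : ℕ → ℕ → Set
InRange p ℓ = (1 ≤ ℓ) × (ℓ ≤ p)

module Tails (s b : ℕ) (a : ℕ → ℕ) where

  legalDecomp-weaken : ∀ {p q m} → p ≤ q → LegalDecomp s b a p m → LegalDecomp s b a q m
  legalDecomp-weaken p≤q D = record
    { indices = indices
    ; inRange = All.map (λ (1≤ℓ , ℓ≤p) → 1≤ℓ , ≤-trans ℓ≤p p≤q) inRange
    ; legal   = legal
    ; sums    = sums
    }
    where open LegalDecomp D

  -- A legal decomposition of m that may replace the summand a_h at the end of
  -- any legal decomposition.
  record LegalTail (p h m : ℕ) : Set where
    field
      decomp  : LegalDecomp s b a p m
      extends : ∀ {x} → LegalPair s b a x h →
                Linked (LegalPair s b a) (x ∷ LegalDecomp.indices decomp)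

  emptyDecomp : ∀ {p} → LegalDecomp s b a p 0
  emptyDecomp = record { indices = [] ; inRange = [] ; legal = [] ; sums = refl }

  open LegalTail

  legalTail-weaken : ∀ {p q h m} → p ≤ q → LegalTail p h m → LegalTail q h m
  legalTail-weaken p≤q T = record { decomp = legalDecomp-weaken p≤q (decomp T) ; extends = extends T }

  legalTail-cons : ∀ {p h h′ m} → InRange p h → LegalPair s b a h h′ →
                   LegalTail p h′ m → LegalTail p h (a h + m)
  legalTail-cons {h = h} h∈ h>h′ T = record
    { decomp = record
      { indices = h ∷ LegalDecomp.indices (decomp T)
      ; inRange = h∈ ∷ LegalDecomp.inRange (decomp T)
      ; legal   = extends T h>h′
      ; sums    = cong (a h +_) (LegalDecomp.sums (decomp T))
      }
    ; extends = λ x>h → x>h ∷ extends T h>h′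
    }

module Generacci (s b : ℕ) (1≤b : 1 ≤ b) (a : ℕ → ℕ) (G : IsGeneracci s b a) where
  open IsGeneracci G
  open Windows s b
  open Tails s b a

  a-mono-< : ∀ {i j} → 1 ≤ i → i < j → a i < a j
  a-mono-< {i} {suc j} 1≤i (s≤s i≤j) with m≤n⇒m<n∨m≡n i≤j
  ... | inj₁ i<j  = <-trans (a-mono-< 1≤i i<j) (increasing j (≤-trans 1≤i (<⇒≤ i<j)))
  ... | inj₂ refl = increasing i 1≤i

  a-mono-≤ : ∀ {i j} → 1 ≤ i → i ≤ j → a i ≤ a j
  a-mono-≤ 1≤i i≤j with m≤n⇒m<n∨m≡n i≤j
  ... | inj₁ i<j  = <⇒≤ (a-mono-< 1≤i i<j)
  ... | inj₂ refl = ≤-refl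

  a-cancel-< : ∀ {x y} → 1 ≤ x → a y < a x → y < x
  a-cancel-< 1≤x ay<ax = ≰⇒> (λ x≤y → <⇒≱ ay<ax (a-mono-≤ 1≤x x≤y))

  legalPair-lower : ∀ {x ℓ y} → 1 ≤ y → y < ℓ → LegalPair s b a x ℓ → LegalPair s b a x y
  legalPair-lower 1≤y y<ℓ (aℓ<ax , disjoint) =
    <-trans (a-mono-< 1≤y y<ℓ) aℓ<ax ,
    λ shared → disjoint (sharesWindow-between 1≤b (<⇒≤ y<ℓ)
                          (<⇒≤ (a-cancel-< (sharesWindow⇒1≤ shared) aℓ<ax)) shared)

  legalTail-below : ∀ {h m} → LegalDecomp s b a h m → LegalTail h (suc h) m
  legalTail-below {h} D = record { decomp = D ; extends = prepend inRange legal }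
    where
      open LegalDecomp D
      prepend : ∀ {x L} → All (InRange h) L → Linked (LegalPair s b a) L →
                LegalPair s b a x (suc h) → Linked (LegalPair s b a) (x ∷ L)
      prepend [] [] _ = [-]
      prepend ((1≤y , y≤h) ∷ _) L-legal x>h = legalPair-lower 1≤y (s≤s y≤h) x>h ∷ L-legal

  legalTail-predecessor : ∀ h → LegalTail h (suc h) (a (suc h) ∸ 1)
  legalTail-predecessor h with a (suc h) | positive (suc h) (s≤s z≤n) | smallest (suc h) (s≤s z≤n)
  ... | zero        | () | _
  ... | suc zero    | _ | _       = record { decomp = emptyDecomp ; extends = λ _ → [-] }
  ... | suc (suc m) | _ | smaller = legalTail-below (smaller (suc m) (s≤s z≤n) ≤-refl)

  sum-positive : ∀ {h t} → 1 ≤ h → 1 ≤ sum (map a (h ∷ t))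
  sum-positive {h} 1≤h = ≤-trans (positive h 1≤h) (m≤m+n (a h) _)

  legalTail-decrement : ∀ {p h t} → All (InRange p) (h ∷ t) → Linked (LegalPair s b a) (h ∷ t) →
                        LegalTail p h (sum (map a (h ∷ t)) ∸ 1)
  legalTail-decrement {h = suc h} ((_ , h<p) ∷ []) _ =
    subst (LegalTail _ _) (cong (_∸ 1) (sym (+-identityʳ (a (suc h)))))
          (legalTail-weaken (<⇒≤ h<p) (legalTail-predecessor h))
  legalTail-decrement {h = h} {h′ ∷ t} (h∈ ∷ rest∈) (h>h′ ∷ rest-legal) =
    subst (LegalTail _ _) (sym (+-∸-assoc (a h) (sum-positive {h′} {t} (proj₁ (All.head rest∈)))))
          (legalTail-cons h∈ h>h′ (legalTail-decrement rest∈ rest-legal))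

lemma2p2 : (s b : ℕ) → 1 ≤ s → 1 ≤ b → (a : ℕ → ℕ) → IsGeneracci s b a →
    (p k : ℕ) → 1 ≤ k → HasLegalDecomp s b a p k →
    HasLegalDecomp s b a p (k ∸ 1)
lemma2p2 s b _ 1≤b a G p k 1≤k record { indices = [] ; sums = refl } with () ← 1≤k
lemma2p2 s b _ 1≤b a G p k _ record { indices = h ∷ t ; inRange = ∈p ; legal = legal ; sums = refl } =
  Tails.LegalTail.decomp (legalTail-decrement ∈p legal)
  where open Generacci s b 1≤b a G
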